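{- For any $m \geq n \geq 1$ it holds $\mathrm{qc}(m,n)\geq n\log_2(m/n)$.
   Context: Search game on the grid $S_1\times\cdots\times S_d$ with $S_i=\{0,\ldots,n_i-1\}$: Adversary fixes a target $t$; Algorithm queries a point $q$; if $q\neq t$, Adversary answers for every coordinate $i$ one of $t_i<q_i$ or $t_i>q_i$, at least one of these $d$ inequalities being true, and Algorithm does not learn which one. $\mathrm{qc}(n_1,\ldots,n_d)$ denotes the minimum number of queries that guarantees finding the target (the query complexity). Here $d=2$. -}

module Defs where

open import Data.Nat using (ℕ; zero; suc)
open import Data.Fin using (Fin; _<_; _>_)
open import Data.Bool using (Bool; true; false)
open import Data.Product using (_×_; _,_; Σ)
open import Data.Sum using (_⊎_)
open import Data.Empty using (⊥)
open import Relation.Binary.PropositionalEquality using (_≡_)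

Point : ℕ → ℕ → Set
Point m n = Fin m × Fin n

Holds : ∀ {k} → Bool → Fin k → Fin k → Set
Holds true  tᵢ qᵢ = tᵢ < qᵢ
Holds false tᵢ qᵢ = tᵢ > qᵢ

Legal : ∀ {m n} → Point m n → Point m n → Bool → Bool → Set
Legal (t₁ , t₂) (q₁ , q₂) a₁ a₂ = Holds a₁ t₁ q₁ ⊎ Holds a₂ t₂ q₂

-- A deterministic adaptive algorithm that makes (at most) k queries:
-- a decision tree whose next query depends on the answers received so far.
data Strategy (m n : ℕ) : ℕ → Set where
  stop  : Strategy m n zero
  query : ∀ {k} → Point m n → (Bool → Bool → Strategy m n k) → Strategy m n (suc k)

Finds : ∀ {m n k} → Strategy m n k → Point m n → Set
Finds stop         t = ⊥
Finds (query q next) t = q ≡ t ⊎ (∀ a₁ a₂ → Legal t q a₁ a₂ → Finds (next a₁ a₂) t)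

Solvable : ℕ → ℕ → ℕ → Set
Solvable m n k = Σ (Strategy m n k) λ S → ∀ t → Finds S t

-- The adversary keeps, in every row j, an interval [lo j, hi j) of columns of
-- still possible targets, the intervals forming a staircase: each lies weakly
-- to the left of the intervals of all later rows. A query whose column misses
-- the interval of its row is answered without shrinking anything; otherwise
-- the adversary cuts that interval at the query and keeps the larger part.
-- In both cases the answer is legal for every remaining candidate, and the
-- weight ∏ⱼ (1 + hi j − lo j) at most halves. It must drop to 1 (all rows
-- empty) before the algorithm can stop. Starting from n blocks of width
-- b = ⌊m/n⌋ gives (b + 1)ⁿ ≤ 2ᵏ, and m ≤ n (b + 1).
module Submission where

open import Defs
open import Data.Nat using (ℕ; _≤_; _*_; _^_)
open import Data.Nat.Base using (zero; suc; _+_; _∸_; _<_; s≤s; NonZero)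
open import Data.Nat.Properties
open import Data.Nat.DivMod using (_/_; _%_; m≡m%n+[m/n]*n; m%n<n; m/n*n≤m)
open import Data.Fin.Base as Fin using (Fin; toℕ; fromℕ<)
open import Data.Fin.Properties as Fin using (toℕ-fromℕ<; toℕ<n)
open import Data.Vec.Functional using (Vector; foldr; updateAt)
open import Data.Vec.Functional.Properties using (updateAt-updates; updateAt-minimal)
open import Data.Bool.Base using (Bool; true; false)
open import Data.Product.Base using (_×_; _,_)
open import Data.Sum.Base using (_⊎_; inj₁; inj₂)
open import Data.Empty using (⊥-elim)
open import Function.Base using (const)
open import Relation.Nullary using (yes; no)
open import Relation.Binary.Definitions using (tri<; tri≈; tri>)
open import Relation.Binary.PropositionalEquality
open import Algebra.Properties.CommutativeSemigroup *-commutativeSemigroup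
  using (interchange; x∙yz≈y∙xz)

^-distribʳ-* : ∀ a c n → (a * c) ^ n ≡ a ^ n * c ^ n
^-distribʳ-* a c zero    = refl
^-distribʳ-* a c (suc n) = begin
  a * c * (a * c) ^ n     ≡⟨ cong (a * c *_) (^-distribʳ-* a c n) ⟩
  a * c * (a ^ n * c ^ n) ≡⟨ interchange a c (a ^ n) (c ^ n) ⟩
  a * a ^ n * (c * c ^ n) ∎
  where open ≡-Reasoning

m≤n*[1+m/n] : ∀ m n .{{_ : NonZero n}} → m ≤ n * suc (m / n)
m≤n*[1+m/n] m n = begin
  m                 ≡⟨ m≡m%n+[m/n]*n m n ⟩
  m % n + m / n * n ≤⟨ +-monoˡ-≤ (m / n * n) (<⇒≤ (m%n<n m n)) ⟩
  n + m / n * n     ≡⟨ cong (n +_) (*-comm (m / n) n) ⟩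
  n + n * (m / n)   ≡⟨ *-suc n (m / n) ⟨
  n * suc (m / n)   ∎
  where open ≤-Reasoning

+-≤-2*-larger : ∀ a c → a + c ≤ 2 * a ⊎ a + c ≤ 2 * c
+-≤-2*-larger a c with ≤-total c a
... | inj₁ c≤a = inj₁ (+-monoʳ-≤ a (≤-trans c≤a (m≤m+n a 0)))
... | inj₂ a≤c = inj₂ (+-mono-≤ a≤c (m≤m+n c 0))

width-split : ∀ {lo x hi} → lo ≤ x → x < hi →
  suc (hi ∸ lo) ≡ suc (x ∸ lo) + suc (hi ∸ suc x)
width-split {lo} {x} {hi} lo≤x x<hi = cong suc (begin
  hi ∸ lo                          ≡⟨ cong (_∸ lo) (m∸n+n≡m x<hi) ⟨
  (hi ∸ suc x) + suc x ∸ lo        ≡⟨ +-∸-assoc (hi ∸ suc x) (≤-trans lo≤x (n≤1+n x)) ⟩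
  (hi ∸ suc x) + (suc x ∸ lo)      ≡⟨ cong ((hi ∸ suc x) +_) (+-∸-assoc 1 lo≤x) ⟩
  (hi ∸ suc x) + suc (x ∸ lo)      ≡⟨ +-comm (hi ∸ suc x) (suc (x ∸ lo)) ⟩
  suc (x ∸ lo) + (hi ∸ suc x)      ≡⟨ +-suc (x ∸ lo) (hi ∸ suc x) ⟨
  x ∸ lo + suc (hi ∸ suc x)        ∎)
  where open ≡-Reasoning

updateAt-pointwise : ∀ {n} {A : Set} (P : Fin n → A → Set) {f : Vector A n} {y v} →
  P y v → (∀ j → P j (f j)) → ∀ j → P j (updateAt f y (const v) j)
updateAt-pointwise P {f} {y} Pyv Pf j with j Fin.≟ y
... | yes refl = subst (P j) (sym (updateAt-updates j f)) Pyv
... | no j≢y   = subst (P j) (sym (updateAt-minimal j y f j≢y)) (Pf j)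

∏ : ∀ {n} → Vector ℕ n → ℕ
∏ = foldr _*_ 1

∏-const : ∀ n c → ∏ {n} (const c) ≡ c ^ n
∏-const zero    c = refl
∏-const (suc n) c = cong (c *_) (∏-const n c)

∏-cong : ∀ {n} {f g : Vector ℕ n} → (∀ j → f j ≡ g j) → ∏ f ≡ ∏ g
∏-cong {zero}  f≗g = refl
∏-cong {suc n} f≗g = cong₂ _*_ (f≗g Fin.zero) (∏-cong (λ j → f≗g (Fin.suc j)))

∏-≤1 : ∀ {n} (f : Vector ℕ n) → (∀ j → f j ≤ 1) → ∏ f ≤ 1
∏-≤1 {zero}  f f≤1 = ≤-refl
∏-≤1 {suc n} f f≤1 = *-mono-≤ (f≤1 Fin.zero) (∏-≤1 (λ j → f (Fin.suc j)) (λ j → f≤1 (Fin.suc j)))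

∏-≤-2*∏ : ∀ {n} (f g : Vector ℕ n) y → f y ≤ 2 * g y →
  (∀ j → j ≢ y → f j ≡ g j) → ∏ f ≤ 2 * ∏ g
∏-≤-2*∏ {suc n} f g Fin.zero fy≤2gy f≗g = begin
  f Fin.zero * ∏ (λ j → f (Fin.suc j))     ≡⟨ cong (f Fin.zero *_) (∏-cong (λ j → f≗g (Fin.suc j) λ ())) ⟩
  f Fin.zero * ∏ (λ j → g (Fin.suc j))     ≤⟨ *-monoˡ-≤ _ fy≤2gy ⟩
  2 * g Fin.zero * ∏ (λ j → g (Fin.suc j)) ≡⟨ *-assoc 2 (g Fin.zero) _ ⟩
  2 * ∏ g                                  ∎
  where open ≤-Reasoning
∏-≤-2*∏ {suc n} f g (Fin.suc y) fy≤2gy f≗g = begin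
  f Fin.zero * ∏ (λ j → f (Fin.suc j))       ≤⟨ *-mono-≤ (≤-reflexive (f≗g Fin.zero λ ())) tail≤ ⟩
  g Fin.zero * (2 * ∏ (λ j → g (Fin.suc j))) ≡⟨ x∙yz≈y∙xz (g Fin.zero) 2 _ ⟩
  2 * ∏ g                                    ∎
  where
  open ≤-Reasoning
  tail≤ : ∏ (λ j → f (Fin.suc j)) ≤ 2 * ∏ (λ j → g (Fin.suc j))
  tail≤ = ∏-≤-2*∏ _ _ y fy≤2gy (λ j j≢y → f≗g (Fin.suc j) (λ eq → j≢y (Fin.suc-injective eq)))

Finds-next : ∀ {m n k} {q : Point m n} {next : Bool → Bool → Strategy m n k} {t} a₁ a₂ →
  Finds (query q next) t → Legal t q a₁ a₂ → Finds (next a₁ a₂) t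
Finds-next a₁ a₂ (inj₂ finds) legal = finds a₁ a₂ legal
Finds-next true  a₂ (inj₁ refl) (inj₁ x<x) = ⊥-elim (<-irrefl refl x<x)
Finds-next false a₂ (inj₁ refl) (inj₁ x<x) = ⊥-elim (<-irrefl refl x<x)
Finds-next a₁ true  (inj₁ refl) (inj₂ y<y) = ⊥-elim (<-irrefl refl y<y)
Finds-next a₁ false (inj₁ refl) (inj₂ y<y) = ⊥-elim (<-irrefl refl y<y)

module Adversary {m n : ℕ} where

  Candidate : (lo hi : Vector ℕ n) → Point m n → Set
  Candidate lo hi (x , y) = lo y ≤ toℕ x × toℕ x < hi y

  record Staircase (lo hi : Vector ℕ n) : Set where
    field
      lo≤hi   : ∀ j → lo j ≤ hi j
      ordered : ∀ {i j} → i Fin.< j → hi i ≤ lo j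
      bounded : ∀ j → hi j ≤ m

  FindsAll : ∀ {k} → Strategy m n k → (lo hi : Vector ℕ n) → Set
  FindsAll S lo hi = ∀ t → Candidate lo hi t → Finds S t

  -- The extra 1 makes the widths of the two parts of a cut add up to the
  -- whole width plus one, so that the larger part has at least half of it.
  width : (lo hi : Vector ℕ n) → Vector ℕ n
  width lo hi j = suc (hi j ∸ lo j)

  module _ {lo hi : Vector ℕ n} (st : Staircase lo hi) where
    open Staircase st

    rightward-legal : ∀ {qx qy} → toℕ qx < lo qy →
      ∀ t → Candidate lo hi t → Legal t (qx , qy) false true
    rightward-legal {qx} {qy} x<lo (tx , ty) (lo≤tx , _) with Fin.<-cmp ty qy
    ... | tri< ty<qy _ _ = inj₂ ty<qy
    ... | tri≈ _ refl _  = inj₁ (<-≤-trans x<lo lo≤tx)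
    ... | tri> _ _ qy<ty = inj₁ (<-≤-trans x<lo (≤-trans (lo≤hi qy) (≤-trans (ordered qy<ty) lo≤tx)))

    leftward-legal : ∀ {qx qy} → hi qy ≤ toℕ qx →
      ∀ t → Candidate lo hi t → Legal t (qx , qy) true false
    leftward-legal {qx} {qy} hi≤x (tx , ty) (_ , tx<hi) with Fin.<-cmp ty qy
    ... | tri> _ _ qy<ty = inj₂ qy<ty
    ... | tri≈ _ refl _  = inj₁ (<-≤-trans tx<hi hi≤x)
    ... | tri< ty<qy _ _ = inj₁ (<-≤-trans tx<hi (≤-trans (ordered ty<qy) (≤-trans (lo≤hi qy) hi≤x)))

    width-stop : FindsAll stop lo hi → ∀ j → width lo hi j ≤ 1
    width-stop finds j with hi j ≤? lo j
    ... | yes hi≤lo = s≤s (≤-reflexive (m≤n⇒m∸n≡0 hi≤lo))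
    ... | no hi≰lo  = ⊥-elim (finds (fromℕ< lo<m , j) (lo≤x , x<hi))
      where
      lo<m : lo j < m
      lo<m = <-≤-trans (≰⇒> hi≰lo) (bounded j)
      lo≤x : lo j ≤ toℕ (fromℕ< lo<m)
      lo≤x = ≤-reflexive (sym (toℕ-fromℕ< lo<m))
      x<hi : toℕ (fromℕ< lo<m) < hi j
      x<hi = subst (_< hi j) (sym (toℕ-fromℕ< lo<m)) (≰⇒> hi≰lo)

  shrink : ∀ {lo hi lo′ hi′} → Staircase lo hi →
    (∀ j → lo j ≤ lo′ j) → (∀ j → hi′ j ≤ hi j) → (∀ j → lo′ j ≤ hi′ j) →
    Staircase lo′ hi′
  shrink st lo≤lo′ hi′≤hi lo′≤hi′ = record
    { lo≤hi   = lo′≤hi′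
    ; ordered = λ {i} {j} i<j → ≤-trans (hi′≤hi i) (≤-trans (ordered i<j) (lo≤lo′ j))
    ; bounded = λ j → ≤-trans (hi′≤hi j) (bounded j)
    }
    where open Staircase st

  FindsAll-next : ∀ {k q} {next : Bool → Bool → Strategy m n k} {lo hi lo′ hi′} a₁ a₂ →
    FindsAll (query q next) lo hi → (∀ j → lo j ≤ lo′ j) → (∀ j → hi′ j ≤ hi j) →
    (∀ t → Candidate lo′ hi′ t → Legal t q a₁ a₂) → FindsAll (next a₁ a₂) lo′ hi′
  FindsAll-next a₁ a₂ finds lo≤lo′ hi′≤hi legal t@(_ , y) cand@(lo′≤x , x<hi′) =
    Finds-next a₁ a₂ (finds t (≤-trans (lo≤lo′ y) lo′≤x , <-≤-trans x<hi′ (hi′≤hi y))) (legal t cand)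

  WeightBound : ∀ {k} → Strategy m n k → Set
  WeightBound {k} S = ∀ {lo hi} → Staircase lo hi → FindsAll S lo hi → ∏ (width lo hi) ≤ 2 ^ k

  module _ {k qx qy} {next : Bool → Bool → Strategy m n k} {lo hi : Vector ℕ n}
           (st : Staircase lo hi) (finds : FindsAll (query (qx , qy) next) lo hi) where
    open Staircase st
    private
      x : ℕ
      x = toℕ qx

    keep-left : WeightBound (next true false) → lo qy ≤ x → x < hi qy →
      width lo hi qy ≤ 2 * suc (x ∸ lo qy) → ∏ (width lo hi) ≤ 2 ^ suc k
    keep-left ih lo≤x x<hi halves = begin
      ∏ (width lo hi)       ≤⟨ ∏-≤-2*∏ (width lo hi) (width lo hi′) qy halves′ elsewhere ⟩
      2 * ∏ (width lo hi′)  ≤⟨ *-monoʳ-≤ 2 (ih st′ finds′) ⟩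
      2 * 2 ^ k             ∎
      where
      open ≤-Reasoning
      hi′ : Vector ℕ n
      hi′ = updateAt hi qy (const x)
      hi′≤hi : ∀ j → hi′ j ≤ hi j
      hi′≤hi = updateAt-pointwise (λ j h → h ≤ hi j) (<⇒≤ x<hi) (λ _ → ≤-refl)
      st′ : Staircase lo hi′
      st′ = shrink st (λ _ → ≤-refl) hi′≤hi (updateAt-pointwise (λ j h → lo j ≤ h) lo≤x lo≤hi)
      finds′ : FindsAll (next true false) lo hi′
      finds′ = FindsAll-next true false finds (λ _ → ≤-refl) hi′≤hi
                 (leftward-legal st′ (≤-reflexive (updateAt-updates qy hi)))
      halves′ : width lo hi qy ≤ 2 * width lo hi′ qy
      halves′ = subst (λ h → width lo hi qy ≤ 2 * suc (h ∸ lo qy)) (sym (updateAt-updates qy hi)) halves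
      elsewhere : ∀ j → j ≢ qy → width lo hi j ≡ width lo hi′ j
      elsewhere j j≢qy = cong (λ h → suc (h ∸ lo j)) (sym (updateAt-minimal j qy hi j≢qy))

    keep-right : WeightBound (next false true) → lo qy ≤ x → x < hi qy →
      width lo hi qy ≤ 2 * suc (hi qy ∸ suc x) → ∏ (width lo hi) ≤ 2 ^ suc k
    keep-right ih lo≤x x<hi halves = begin
      ∏ (width lo hi)       ≤⟨ ∏-≤-2*∏ (width lo hi) (width lo′ hi) qy halves′ elsewhere ⟩
      2 * ∏ (width lo′ hi)  ≤⟨ *-monoʳ-≤ 2 (ih st′ finds′) ⟩
      2 * 2 ^ k             ∎
      where
      open ≤-Reasoning
      lo′ : Vector ℕ n
      lo′ = updateAt lo qy (const (suc x))
      lo≤lo′ : ∀ j → lo j ≤ lo′ j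
      lo≤lo′ = updateAt-pointwise (λ j l → lo j ≤ l) (≤-trans lo≤x (n≤1+n x)) (λ _ → ≤-refl)
      st′ : Staircase lo′ hi
      st′ = shrink st lo≤lo′ (λ _ → ≤-refl) (updateAt-pointwise (λ j l → l ≤ hi j) x<hi lo≤hi)
      finds′ : FindsAll (next false true) lo′ hi
      finds′ = FindsAll-next false true finds lo≤lo′ (λ _ → ≤-refl)
                 (rightward-legal st′ (≤-reflexive (sym (updateAt-updates qy lo))))
      halves′ : width lo hi qy ≤ 2 * width lo′ hi qy
      halves′ = subst (λ l → width lo hi qy ≤ 2 * suc (hi qy ∸ l)) (sym (updateAt-updates qy lo)) halves
      elsewhere : ∀ j → j ≢ qy → width lo hi j ≡ width lo′ hi j
      elsewhere j j≢qy = cong (λ l → suc (hi j ∸ l)) (sym (updateAt-minimal j qy lo j≢qy))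

    query-weightBound : (∀ a₁ a₂ → WeightBound (next a₁ a₂)) → ∏ (width lo hi) ≤ 2 ^ suc k
    query-weightBound ih with x <? lo qy | hi qy ≤? x
    ... | yes x<lo | _ = ≤-trans (ih false true st finds′) (m≤n*m _ 2)
      where
      finds′ : FindsAll (next false true) lo hi
      finds′ = FindsAll-next false true finds (λ _ → ≤-refl) (λ _ → ≤-refl) (rightward-legal st x<lo)
    ... | no _ | yes hi≤x = ≤-trans (ih true false st finds′) (m≤n*m _ 2)
      where
      finds′ : FindsAll (next true false) lo hi
      finds′ = FindsAll-next true false finds (λ _ → ≤-refl) (λ _ → ≤-refl) (leftward-legal st hi≤x)
    ... | no x≮lo | no hi≰x = cut (≮⇒≥ x≮lo) (≰⇒> hi≰x)
      where
      cut : lo qy ≤ x → x < hi qy → ∏ (width lo hi) ≤ 2 ^ suc k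
      cut lo≤x x<hi with +-≤-2*-larger (suc (x ∸ lo qy)) (suc (hi qy ∸ suc x))
      ... | inj₁ left  = keep-left (ih true false) lo≤x x<hi (≤-trans (≤-reflexive (width-split lo≤x x<hi)) left)
      ... | inj₂ right = keep-right (ih false true) lo≤x x<hi (≤-trans (≤-reflexive (width-split lo≤x x<hi)) right)

  weightBound : ∀ {k} (S : Strategy m n k) → WeightBound S
  weightBound stop           st finds = ∏-≤1 _ (width-stop st finds)
  weightBound (query q next) st finds = query-weightBound st finds (λ a₁ a₂ → weightBound (next a₁ a₂))

  blockLo blockHi : ℕ → Vector ℕ n
  blockLo b j = b * toℕ j
  blockHi b j = b * suc (toℕ j)

  blocks-staircase : ∀ b → b * n ≤ m → Staircase (blockLo b) (blockHi b)
  blocks-staircase b bn≤m = record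
    { lo≤hi   = λ j → *-monoʳ-≤ b (n≤1+n (toℕ j))
    ; ordered = *-monoʳ-≤ b
    ; bounded = λ j → ≤-trans (*-monoʳ-≤ b (toℕ<n j)) bn≤m
    }

  ∏-width-blocks : ∀ b → ∏ (width (blockLo b) (blockHi b)) ≡ suc b ^ n
  ∏-width-blocks b = trans (∏-cong width≡) (∏-const n (suc b))
    where
    width≡ : ∀ j → width (blockLo b) (blockHi b) j ≡ suc b
    width≡ j = cong suc (trans (cong (_∸ b * toℕ j) (*-suc b (toℕ j))) (m+n∸n≡m b (b * toℕ j)))

lemma8 : (m n : ℕ) → 1 ≤ n → n ≤ m →
    (k : ℕ) → Solvable m n k → m ^ n ≤ n ^ n * 2 ^ k
lemma8 m n@(suc _) _ _ k (S , finds) = begin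
  m ^ n               ≤⟨ ^-monoˡ-≤ n (m≤n*[1+m/n] m n) ⟩
  (n * suc b) ^ n     ≡⟨ ^-distribʳ-* n (suc b) n ⟩
  n ^ n * suc b ^ n   ≡⟨ cong (n ^ n *_) (∏-width-blocks b) ⟨
  n ^ n * ∏ (width (blockLo b) (blockHi b))
                      ≤⟨ *-monoʳ-≤ (n ^ n) (weightBound S (blocks-staircase b (m/n*n≤m m n)) (λ t _ → finds t)) ⟩
  n ^ n * 2 ^ k       ∎
  where
  open ≤-Reasoning
  open Adversary {m} {n}
  b : ℕ
  b = m / n
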